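{- Let $G_1$ and $G_2$ be graphs. Suppose that the false-twin equivalence classes of $G_1$ are $G^1_1,\dots,G^1_r$ and those of $G_2$ are $G^2_1,\dots,G^2_s$, and that $|G^1_i|\ge 2$ for every $i$ and $|G^2_j|\ge 2$ for every $j$. Then $\mathrm{fix}(G_1*G_2)=|V(G_1)|\,|V(G_2)|-rs$.
   Context: All graphs are finite and simple. For graphs $G_1,G_2$, the co-normal product $G_1*G_2$ is the graph with vertex set $V(G_1)\times V(G_2)$ in which $(a,b)$ and $(c,d)$ are adjacent if and only if $a$ is adjacent to $c$ in $G_1$ or $b$ is adjacent to $d$ in $G_2$. The false-twin equivalence classes of a graph $G$ are the classes of the equivalence relation on $V(G)$ given by $u\equiv v$ iff $N(u)=N(v)$ (open neighborhoods). A set $F\subseteq V(G)$ is a fixing set of $G$ if the only automorphism of $G$ fixing every vertex of $F$ is the identity; $\mathrm{fix}(G)$ is the minimum cardinality of a fixing set. -}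

module Defs where

open import Data.Nat using (ℕ; _*_; _≤_)
open import Data.Bool using (Bool; true; false; _∨_)
open import Data.Fin using (Fin; quotient; remainder)
open import Data.Fin.Subset using (Subset; _∈_; ∣_∣)
open import Data.Fin.Permutation using (Permutation′; _⟨$⟩ʳ_)
open import Data.Product using (Σ; ∃; _×_; _,_)
open import Relation.Binary.PropositionalEquality using (_≡_; _≢_)
open import Function.Bundles using (_⇔_)

record Graph (n : ℕ) : Set where
  field
    adj     : Fin n → Fin n → Bool
    sym     : ∀ u v → adj u v ≡ adj v u
    irrefl  : ∀ v → adj v v ≡ false
open Graph public

-- Co-normal product G₁ * G₂ on vertex set V(G₁) × V(G₂), encoded as Fin (n * m)
-- via the standard bijection (Data.Fin.combine / quotient / remainder).
-- (a,b) ~ (c,d) iff a ~ c in G₁ or b ~ d in G₂.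
conormal : ∀ {n m} → Graph n → Graph m → Graph (n * m)
conormal {n} {m} G₁ G₂ = record
  { adj    = λ x y → adj G₁ (quotient m x) (quotient m y)
                     ∨ adj G₂ (remainder {n} m x) (remainder {n} m y)
  ; sym    = λ x y → cong₂∨ (sym G₁ (quotient m x) (quotient m y))
                            (sym G₂ (remainder {n} m x) (remainder {n} m y))
  ; irrefl = λ x → cong₂∨ (irrefl G₁ (quotient m x)) (irrefl G₂ (remainder {n} m x))
  }
  where
  cong₂∨ : ∀ {a b c d} → a ≡ b → c ≡ d → (a ∨ c) ≡ (b ∨ d)
  cong₂∨ _≡_.refl _≡_.refl = _≡_.refl

IsAutomorphism : ∀ {n} → Graph n → Permutation′ n → Set
IsAutomorphism G σ = ∀ u v → adj G (σ ⟨$⟩ʳ u) (σ ⟨$⟩ʳ v) ≡ adj G u v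

IsFixingSet : ∀ {n} → Graph n → Subset n → Set
IsFixingSet {n} G F =
  (σ : Permutation′ n) → IsAutomorphism G σ →
  (∀ v → v ∈ F → σ ⟨$⟩ʳ v ≡ v) → ∀ v → σ ⟨$⟩ʳ v ≡ v

IsFixingNumber : ∀ {n} → Graph n → ℕ → Set
IsFixingNumber {n} G k =
  (Σ (Subset n) λ F → IsFixingSet G F × ∣ F ∣ ≡ k)
  × ((F : Subset n) → IsFixingSet G F → k ≤ ∣ F ∣)

FalseTwins : ∀ {n} → Graph n → Fin n → Fin n → Set
FalseTwins {n} G u v = ∀ (w : Fin n) → adj G u w ≡ adj G v w

IsFalseTwinClassLabelling : ∀ {n} → Graph n → (r : ℕ) → (Fin n → Fin r) → Set
IsFalseTwinClassLabelling {n} G r c =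
  (∀ (i : Fin r) → ∃ λ v → c v ≡ i)
  × (∀ (u v : Fin n) → (c u ≡ c v) ⇔ FalseTwins G u v)

AllClassesNontrivial : ∀ {n r} → (Fin n → Fin r) → Set
AllClassesNontrivial {n} {r} c =
  ∀ (i : Fin r) → Σ (Fin n) λ u → Σ (Fin n) λ v → u ≢ v × c u ≡ i × c v ≡ i

module Submission where

-- The theorem is an instance of a statement about a single graph G on N
-- vertices: if the false-twin classes of G are labelled by Fin k and every
-- class has at least two vertices, then fix(G) = N ∸ k.
--   * Lower bound: swapping two false twins is an automorphism, so a fixing
--     set F misses at most one vertex of each class; the label map is thus
--     injective on the complement of F, and ∣ ∁ F ∣ ≤ k.
--   * Upper bound: choose one representative per class and let F be the set
--     of all other vertices.  An automorphism fixing F maps each class to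
--     itself (every class meets F), hence also fixes the representatives.
-- For the product we show that (a,b) and (c,d) are false twins in G₁ * G₂
-- iff a,c are false twins in G₁ and b,d are false twins in G₂.  So labelling
-- (a,b) by the pair of labels of a and b labels the false-twin classes of the
-- product by Fin (r * s), every product class is nontrivial, and the single
-- graph statement gives fix(G₁ * G₂) = n * m ∸ r * s.

open import Defs hiding (sym)
open import Data.Nat using (ℕ; _*_; _∸_; _≤_)
open import Data.Nat.Properties using (≤-antisym; ≤-trans; ≤-reflexive; ∸-monoʳ-≤; m∸[m∸n]≡n)
open import Data.Bool using (Bool; true; false; _∨_)
open import Data.Bool.Properties using (∨-identityʳ; ∨-zeroʳ; ∨-comm)
open import Data.Fin using (Fin; zero; suc; quotient; remainder; combine; _≟_)
open import Data.Fin.Properties using (suc-injective; injective⇒≤; remQuot-combine; combine-remQuot; combine-injective; combine-injectiveˡ)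
open import Data.Fin.Subset using (Subset; _∈_; ∣_∣; ∁; inside; outside)
open import Data.Fin.Subset.Properties using (∣∁p∣≡n∸∣p∣; x∈∁p⇒x∉p; x∉p⇒x∈∁p; ∣p∣≤n)
open import Data.Fin.Permutation using (Permutation′; _⟨$⟩ʳ_; _⟨$⟩ˡ_; inverseˡ; inverseʳ; transpose)
import Data.Fin.Permutation.Components as Components
open import Data.Vec using (_∷_; tabulate; here; there)
open import Data.Vec.Properties using (lookup∘tabulate; []=⇒lookup; lookup⇒[]=)
open import Data.Product using (∃; _×_; _,_; proj₁; proj₂)
open import Function.Bundles using (_⇔_; mk⇔; Equivalence)
open import Function.Definitions using (Injective)
open import Relation.Binary.PropositionalEquality using (_≡_; _≢_; refl; sym; trans; cong; cong₂; module ≡-Reasoning)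
open import Relation.Nullary using (Dec; yes; no; does; ¬_)
open import Relation.Nullary.Decidable using (dec-true)
open import Data.Empty using (⊥-elim)

open ≡-Reasoning

-- Counting subsets of Fin N.

enum : ∀ {N} (S : Subset N) → Fin ∣ S ∣ → Fin N
enum (inside  ∷ S) zero    = zero
enum (inside  ∷ S) (suc i) = suc (enum S i)
enum (outside ∷ S) i       = suc (enum S i)

enum∈ : ∀ {N} (S : Subset N) i → enum S i ∈ S
enum∈ (inside  ∷ S) zero    = here
enum∈ (inside  ∷ S) (suc i) = there (enum∈ S i)
enum∈ (outside ∷ S) i       = there (enum∈ S i)

enum-injective : ∀ {N} (S : Subset N) → Injective _≡_ _≡_ (enum S)
enum-injective (inside  ∷ S) {zero}  {zero}  _ = refl
enum-injective (inside  ∷ S) {suc i} {suc j} e = cong suc (enum-injective S (suc-injective e))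
enum-injective (outside ∷ S)                 e = enum-injective S (suc-injective e)

index : ∀ {N} (S : Subset N) {v} → v ∈ S → Fin ∣ S ∣
index (inside  ∷ S) here      = zero
index (inside  ∷ S) (there p) = suc (index S p)
index (outside ∷ S) (there p) = index S p

enum-index : ∀ {N} (S : Subset N) {v} (p : v ∈ S) → enum S (index S p) ≡ v
enum-index (inside  ∷ S) here      = refl
enum-index (inside  ∷ S) (there p) = cong suc (enum-index S p)
enum-index (outside ∷ S) (there p) = cong suc (enum-index S p)

∣S∣≤-injectiveOn : ∀ {N k} (S : Subset N) (f : Fin N → Fin k) →
  (∀ {u v} → u ∈ S → v ∈ S → f u ≡ f v → u ≡ v) → ∣ S ∣ ≤ k
∣S∣≤-injectiveOn S f inj =
  injective⇒≤ (λ e → enum-injective S (inj (enum∈ S _) (enum∈ S _) e))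

≤∣S∣-injectionInto : ∀ {N k} (S : Subset N) (g : Fin k → Fin N) →
  Injective _≡_ _≡_ g → (∀ i → g i ∈ S) → k ≤ ∣ S ∣
≤∣S∣-injectionInto S g inj g∈S = injective⇒≤ index-injective
  where
  index-injective : Injective _≡_ _≡_ (λ i → index S (g∈S i))
  index-injective {i} {j} e = inj (begin
    g i                      ≡⟨ sym (enum-index S (g∈S i)) ⟩
    enum S (index S (g∈S i)) ≡⟨ cong (enum S) e ⟩
    enum S (index S (g∈S j)) ≡⟨ enum-index S (g∈S j) ⟩
    g j                      ∎)

filterSubset : ∀ {N} {P : Fin N → Set} → (∀ v → Dec (P v)) → Subset N
filterSubset P? = tabulate (λ v → does (P? v))

∈filter⁺ : ∀ {N} {P : Fin N → Set} (P? : ∀ v → Dec (P v)) {v} → P v → v ∈ filterSubset P?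
∈filter⁺ P? {v} p = lookup⇒[]= v _ (trans (lookup∘tabulate _ v) (dec-true (P? v) p))

∈filter⁻ : ∀ {N} {P : Fin N → Set} (P? : ∀ v → Dec (P v)) {v} → v ∈ filterSubset P? → P v
∈filter⁻ P? {v} v∈ with P? v | trans (sym (lookup∘tabulate _ v)) ([]=⇒lookup v∈)
... | yes p | _ = p
... | no _  | ()

-- False twins and automorphisms.

perm-injective : ∀ {N} (σ : Permutation′ N) → Injective _≡_ _≡_ (σ ⟨$⟩ʳ_)
perm-injective σ e = trans (sym (inverseˡ σ)) (trans (cong (σ ⟨$⟩ˡ_) e) (inverseˡ σ))

transpose-moves : ∀ {N} (u v : Fin N) → Components.transpose u v u ≡ v
transpose-moves u v with u ≟ u
... | yes _  = refl
... | no u≢u = ⊥-elim (u≢u refl)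

transpose-fixes : ∀ {N} (u v k : Fin N) → k ≢ u → k ≢ v → Components.transpose u v k ≡ k
transpose-fixes u v k k≢u k≢v with k ≟ u
... | yes k≡u = ⊥-elim (k≢u k≡u)
... | no _ with k ≟ v
...   | yes k≡v = ⊥-elim (k≢v k≡v)
...   | no _    = refl

module Twins {N} (G : Graph N) where

  twins-sym : ∀ {a b} → FalseTwins G a b → FalseTwins G b a
  twins-sym t w = sym (t w)

  transpose-twin : ∀ {u v} → FalseTwins G u v → ∀ k → FalseTwins G (Components.transpose u v k) k
  transpose-twin {u} {v} t k with k ≟ u
  ... | yes refl = twins-sym t
  ... | no _ with k ≟ v
  ...   | yes refl = t
  ...   | no _     = λ _ → refl

  transpose-isAutomorphism : ∀ {u v} → FalseTwins G u v → IsAutomorphism G (transpose u v)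
  transpose-isAutomorphism {u} {v} t x y = begin
    adj G (τ x) (τ y) ≡⟨ transpose-twin t x (τ y) ⟩
    adj G x (τ y)     ≡⟨ Graph.sym G x (τ y) ⟩
    adj G (τ y) x     ≡⟨ transpose-twin t y x ⟩
    adj G y x         ≡⟨ Graph.sym G y x ⟩
    adj G x y         ∎
    where
    τ : Fin N → Fin N
    τ = Components.transpose u v

  automorphism-preserves-twins : (σ : Permutation′ N) → IsAutomorphism G σ →
    ∀ {a b} → FalseTwins G a b → FalseTwins G (σ ⟨$⟩ʳ a) (σ ⟨$⟩ʳ b)
  automorphism-preserves-twins σ aut {a} {b} t x = begin
    adj G (σ ⟨$⟩ʳ a) x                  ≡⟨ cong (adj G (σ ⟨$⟩ʳ a)) (sym (inverseʳ σ)) ⟩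
    adj G (σ ⟨$⟩ʳ a) (σ ⟨$⟩ʳ (σ ⟨$⟩ˡ x)) ≡⟨ aut a (σ ⟨$⟩ˡ x) ⟩
    adj G a (σ ⟨$⟩ˡ x)                  ≡⟨ t (σ ⟨$⟩ˡ x) ⟩
    adj G b (σ ⟨$⟩ˡ x)                  ≡⟨ sym (aut b (σ ⟨$⟩ˡ x)) ⟩
    adj G (σ ⟨$⟩ʳ b) (σ ⟨$⟩ʳ (σ ⟨$⟩ˡ x)) ≡⟨ cong (adj G (σ ⟨$⟩ʳ b)) (inverseʳ σ) ⟩
    adj G (σ ⟨$⟩ʳ b) x                  ∎

-- The fixing number of a graph whose false-twin classes are all nontrivial.

module FixingNumber {N k} (G : Graph N) (c : Fin N → Fin k) where
  open Twins G

  -- Lower bound.  Two vertices outside a fixing set F cannot share a label: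
  -- otherwise they are twins and swapping them is an automorphism fixing F.
  fixingSet-lowerBound : (∀ u v → c u ≡ c v → FalseTwins G u v) →
    ∀ F → IsFixingSet G F → N ∸ k ≤ ∣ F ∣
  fixingSet-lowerBound sameLabel⇒twins F fixing =
    ≤-trans (∸-monoʳ-≤ N ∣∁F∣≤k) (≤-reflexive (m∸[m∸n]≡n (∣p∣≤n F)))
    where
    label-injective : ∀ {u v} → u ∈ ∁ F → v ∈ ∁ F → c u ≡ c v → u ≡ v
    label-injective {u} {v} u∉F v∉F e =
      trans (sym (fixing (transpose u v) swap-aut swap-fixes-F u)) (transpose-moves u v)
      where
      swap-aut : IsAutomorphism G (transpose u v)
      swap-aut = transpose-isAutomorphism (sameLabel⇒twins u v e)
      swap-fixes-F : ∀ x → x ∈ F → transpose u v ⟨$⟩ʳ x ≡ x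
      swap-fixes-F x x∈F = transpose-fixes u v x
        (λ { refl → x∈∁p⇒x∉p u∉F x∈F }) (λ { refl → x∈∁p⇒x∉p v∉F x∈F })
    ∣∁F∣≤k : N ∸ ∣ F ∣ ≤ k
    ∣∁F∣≤k = ≤-trans (≤-reflexive (sym (∣∁p∣≡n∸∣p∣ F))) (∣S∣≤-injectiveOn (∁ F) c label-injective)

  -- Upper bound, via the set of all vertices except one representative per class.
  module Representatives (labelling : IsFalseTwinClassLabelling G k c)
                         (nontrivial : AllClassesNontrivial c) where

    rep : Fin k → Fin N
    rep i = proj₁ (proj₁ labelling i)

    rep-label : ∀ i → c (rep i) ≡ i
    rep-label i = proj₂ (proj₁ labelling i)

    IsRep : Fin N → Set
    IsRep v = v ≡ rep (c v)

    isRep? : ∀ v → Dec (IsRep v)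
    isRep? v = v ≟ rep (c v)

    Reps : Subset N
    Reps = filterSubset isRep?

    ∣Reps∣≡k : ∣ Reps ∣ ≡ k
    ∣Reps∣≡k = ≤-antisym
      (∣S∣≤-injectiveOn Reps c (λ u∈ v∈ e →
         trans (∈filter⁻ isRep? u∈) (trans (cong rep e) (sym (∈filter⁻ isRep? v∈)))))
      (≤∣S∣-injectionInto Reps rep
         (λ {i} {j} e → trans (sym (rep-label i)) (trans (cong c e) (rep-label j)))
         (λ i → ∈filter⁺ isRep? (cong rep (sym (rep-label i)))))

    nonRep∈∁Reps : ∀ {v} → ¬ IsRep v → v ∈ ∁ Reps
    nonRep∈∁Reps ¬rep = x∉p⇒x∈∁p (λ v∈ → ¬rep (∈filter⁻ isRep? v∈))

    partner : ∀ v → ∃ λ w → w ≢ v × c w ≡ c v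
    partner v with nontrivial (c v)
    ... | u₁ , u₂ , u₁≢u₂ , cu₁ , cu₂ with u₁ ≟ v
    ...   | yes refl = u₂ , (λ u₂≡u₁ → u₁≢u₂ (sym u₂≡u₁)) , cu₂
    ...   | no u₁≢v  = u₁ , u₁≢v , cu₁

    -- An automorphism fixing the non-representatives preserves every class:
    -- the class of v contains a non-representative w, and σ v is a twin of σ w = w.
    preserves-labels : (σ : Permutation′ N) → IsAutomorphism G σ →
      (∀ v → v ∈ ∁ Reps → σ ⟨$⟩ʳ v ≡ v) → ∀ v → IsRep v → c (σ ⟨$⟩ʳ v) ≡ c v
    preserves-labels σ aut fixed v v-rep with partner v
    ... | w , w≢v , cw≡cv = trans (Equivalence.from (proj₂ labelling _ w) σv-twin-w) cw≡cv
      where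
      σw≡w : σ ⟨$⟩ʳ w ≡ w
      σw≡w = fixed w (nonRep∈∁Reps (λ w-rep → w≢v (trans w-rep (trans (cong rep cw≡cv) (sym v-rep)))))
      σv-twin-w : FalseTwins G (σ ⟨$⟩ʳ v) w
      σv-twin-w x = trans
        (automorphism-preserves-twins σ aut (Equivalence.to (proj₂ labelling v w) (sym cw≡cv)) x)
        (cong (λ z → adj G z x) σw≡w)

    -- An automorphism fixing the non-representatives is the identity: a
    -- representative v is sent to its own class, so σ v is either the
    -- representative v itself, or a fixed non-representative, whence σ v = v.
    ∁Reps-fixing : IsFixingSet G (∁ Reps)
    ∁Reps-fixing σ aut fixed v with isRep? v
    ... | no ¬rep = fixed v (nonRep∈∁Reps ¬rep)
    ... | yes v-rep with isRep? (σ ⟨$⟩ʳ v)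
    ...   | yes σv-rep = trans σv-rep (trans (cong rep (preserves-labels σ aut fixed v v-rep)) (sym v-rep))
    ...   | no ¬σv-rep = perm-injective σ (fixed (σ ⟨$⟩ʳ v) (nonRep∈∁Reps ¬σv-rep))

    ∣∁Reps∣≡N∸k : ∣ ∁ Reps ∣ ≡ N ∸ k
    ∣∁Reps∣≡N∸k = trans (∣∁p∣≡n∸∣p∣ Reps) (cong (N ∸_) ∣Reps∣≡k)

  fixingNumber : IsFalseTwinClassLabelling G k c → AllClassesNontrivial c →
    IsFixingNumber G (N ∸ k)
  fixingNumber labelling nontrivial =
    (∁ Reps , ∁Reps-fixing , ∣∁Reps∣≡N∸k) ,
    fixingSet-lowerBound (λ u v → Equivalence.to (proj₂ labelling u v))
    where open Representatives labelling nontrivial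

-- False twins in the co-normal product.

∨-cancel : ∀ t {a b} → a ≡ b ∨ t → a ∨ t ≡ b → a ≡ b
∨-cancel false {a} {b} p _ = trans p (∨-identityʳ b)
∨-cancel true  {a} {b} p q = trans p (trans (∨-zeroʳ b) (trans (sym (∨-zeroʳ a)) q))

module Conormal {n m} (G₁ : Graph n) (G₂ : Graph m) where

  P : Graph (n * m)
  P = conormal G₁ G₂

  π₁ : Fin (n * m) → Fin n
  π₁ x = quotient m x

  π₂ : Fin (n * m) → Fin m
  π₂ x = remainder {n} m x

  π₁-combine : ∀ a b → π₁ (combine a b) ≡ a
  π₁-combine a b = cong proj₁ (remQuot-combine {n} {m} a b)

  π₂-combine : ∀ a b → π₂ (combine a b) ≡ b
  π₂-combine a b = cong proj₂ (remQuot-combine {n} {m} a b)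

  adj-combine : ∀ x a b → adj P x (combine a b) ≡ adj G₁ (π₁ x) a ∨ adj G₂ (π₂ x) b
  adj-combine x a b = cong₂ (λ a′ b′ → adj G₁ (π₁ x) a′ ∨ adj G₂ (π₂ x) b′) (π₁-combine a b) (π₂-combine a b)

  twins-pairs : ∀ {x y} → FalseTwins P x y →
    ∀ a b → adj G₁ (π₁ x) a ∨ adj G₂ (π₂ x) b ≡ adj G₁ (π₁ y) a ∨ adj G₂ (π₂ y) b
  twins-pairs {x} {y} T a b =
    trans (sym (adj-combine x a b)) (trans (T (combine a b)) (adj-combine y a b))

  twins-product⁺ : ∀ {x y} → FalseTwins G₁ (π₁ x) (π₁ y) → FalseTwins G₂ (π₂ x) (π₂ y) →
    FalseTwins P x y
  twins-product⁺ t₁ t₂ w = cong₂ _∨_ (t₁ (π₁ w)) (t₂ (π₂ w))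

  -- Conversely, test adjacency against (a, π₂ x) and (a, π₂ y): the second
  -- coordinate contributes nothing to one side and the same bit to the other.
  twins-product⁻₁ : ∀ {x y} → FalseTwins P x y → FalseTwins G₁ (π₁ x) (π₁ y)
  twins-product⁻₁ {x} {y} T a = ∨-cancel (adj G₂ (π₂ x) (π₂ y)) toward-x toward-y
    where
    A B : Bool
    A = adj G₁ (π₁ x) a
    B = adj G₁ (π₁ y) a
    toward-x : A ≡ B ∨ adj G₂ (π₂ x) (π₂ y)
    toward-x = begin
      A                              ≡⟨ sym (∨-identityʳ A) ⟩
      A ∨ false                      ≡⟨ cong (A ∨_) (sym (irrefl G₂ (π₂ x))) ⟩
      A ∨ adj G₂ (π₂ x) (π₂ x)       ≡⟨ twins-pairs T a (π₂ x) ⟩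
      B ∨ adj G₂ (π₂ y) (π₂ x)       ≡⟨ cong (B ∨_) (Graph.sym G₂ (π₂ y) (π₂ x)) ⟩
      B ∨ adj G₂ (π₂ x) (π₂ y)       ∎
    toward-y : A ∨ adj G₂ (π₂ x) (π₂ y) ≡ B
    toward-y = begin
      A ∨ adj G₂ (π₂ x) (π₂ y)       ≡⟨ twins-pairs T a (π₂ y) ⟩
      B ∨ adj G₂ (π₂ y) (π₂ y)       ≡⟨ cong (B ∨_) (irrefl G₂ (π₂ y)) ⟩
      B ∨ false                      ≡⟨ ∨-identityʳ B ⟩
      B                              ∎

  -- The same argument in the second coordinate, testing against (π₁ x, b) and (π₁ y, b).
  twins-product⁻₂ : ∀ {x y} → FalseTwins P x y → FalseTwins G₂ (π₂ x) (π₂ y)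
  twins-product⁻₂ {x} {y} T b = ∨-cancel (adj G₁ (π₁ x) (π₁ y)) toward-x toward-y
    where
    A B : Bool
    A = adj G₂ (π₂ x) b
    B = adj G₂ (π₂ y) b
    toward-x : A ≡ B ∨ adj G₁ (π₁ x) (π₁ y)
    toward-x = begin
      A                              ≡⟨ cong (_∨ A) (sym (irrefl G₁ (π₁ x))) ⟩
      adj G₁ (π₁ x) (π₁ x) ∨ A       ≡⟨ twins-pairs T (π₁ x) b ⟩
      adj G₁ (π₁ y) (π₁ x) ∨ B       ≡⟨ cong (_∨ B) (Graph.sym G₁ (π₁ y) (π₁ x)) ⟩
      adj G₁ (π₁ x) (π₁ y) ∨ B       ≡⟨ ∨-comm _ B ⟩
      B ∨ adj G₁ (π₁ x) (π₁ y)       ∎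
    toward-y : A ∨ adj G₁ (π₁ x) (π₁ y) ≡ B
    toward-y = begin
      A ∨ adj G₁ (π₁ x) (π₁ y)       ≡⟨ ∨-comm A _ ⟩
      adj G₁ (π₁ x) (π₁ y) ∨ A       ≡⟨ twins-pairs T (π₁ y) b ⟩
      adj G₁ (π₁ y) (π₁ y) ∨ B       ≡⟨ cong (_∨ B) (irrefl G₁ (π₁ y)) ⟩
      B                              ∎

  module ProductLabel {r s} (c₁ : Fin n → Fin r) (c₂ : Fin m → Fin s) where

    label : Fin (n * m) → Fin (r * s)
    label x = combine (c₁ (π₁ x)) (c₂ (π₂ x))

    label-combine : ∀ a b → label (combine a b) ≡ combine (c₁ a) (c₂ b)
    label-combine a b = cong₂ (λ a′ b′ → combine (c₁ a′) (c₂ b′)) (π₁-combine a b) (π₂-combine a b)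

    label-combine-onto : ∀ i {a b} → c₁ a ≡ quotient {r} s i → c₂ b ≡ remainder {r} s i →
      label (combine a b) ≡ i
    label-combine-onto i {a} {b} ca cb = begin
      label (combine a b)                          ≡⟨ label-combine a b ⟩
      combine (c₁ a) (c₂ b)                        ≡⟨ cong₂ combine ca cb ⟩
      combine (quotient {r} s i) (remainder {r} s i)   ≡⟨ combine-remQuot {r} s i ⟩
      i                                            ∎

    label-isLabelling : IsFalseTwinClassLabelling G₁ r c₁ → IsFalseTwinClassLabelling G₂ s c₂ →
      IsFalseTwinClassLabelling P (r * s) label
    label-isLabelling (onto₁ , twins₁) (onto₂ , twins₂) = onto , twins
      where
      onto : ∀ i → ∃ λ x → label x ≡ i
      onto i with onto₁ (quotient {r} s i) | onto₂ (remainder {r} s i)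
      ... | a , ca | b , cb = combine a b , label-combine-onto i ca cb
      twins : ∀ u v → (label u ≡ label v) ⇔ FalseTwins P u v
      twins u v = mk⇔
        (λ e → let (e₁ , e₂) = combine-injective _ _ _ _ e in
          twins-product⁺ (Equivalence.to (twins₁ _ _) e₁) (Equivalence.to (twins₂ _ _) e₂))
        (λ T → cong₂ combine (Equivalence.from (twins₁ _ _) (twins-product⁻₁ T))
                             (Equivalence.from (twins₂ _ _) (twins-product⁻₂ T)))

    label-nontrivial : AllClassesNontrivial c₁ → (∀ j → ∃ λ b → c₂ b ≡ j) →
      AllClassesNontrivial label
    label-nontrivial nontrivial₁ onto₂ i
      with nontrivial₁ (quotient {r} s i) | onto₂ (remainder {r} s i)
    ... | a , a′ , a≢a′ , ca , ca′ | b , cb =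
      combine a b , combine a′ b ,
      (λ e → a≢a′ (combine-injectiveˡ a b a′ b e)) ,
      label-combine-onto i ca cb , label-combine-onto i ca′ cb

theorem3p11 : ∀ {n m} (G₁ : Graph n) (G₂ : Graph m)
    (r s : ℕ) (c₁ : Fin n → Fin r) (c₂ : Fin m → Fin s) →
    IsFalseTwinClassLabelling G₁ r c₁ → IsFalseTwinClassLabelling G₂ s c₂ →
    AllClassesNontrivial c₁ → AllClassesNontrivial c₂ →
    IsFixingNumber (conormal G₁ G₂) (n * m ∸ r * s)
theorem3p11 G₁ G₂ r s c₁ c₂ labelling₁ labelling₂ nontrivial₁ _ =
  FixingNumber.fixingNumber (conormal G₁ G₂) label
    (label-isLabelling labelling₁ labelling₂)
    (label-nontrivial nontrivial₁ (proj₁ labelling₂))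
  where open Conormal.ProductLabel G₁ G₂ c₁ c₂
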